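{- Let $M_1,M_2,N_1,N_2\models T_{\mathrm{base}}$ and $k\in\mathbb{N}$. If $M_1\approx_k N_1$ and $M_2\approx_k N_2$, then $M_1\oplus M_2\approx_k N_1\oplus N_2$.
   Context: Let $\mathcal{L}=\{\subseteq,\bot,\mathrm{At},\lhd\}$ be the first-order language with binary relation symbols $\subseteq,\lhd$, a constant $\bot$ and a unary relation symbol $\mathrm{At}$. Lowercase variables range over atoms (elements satisfying $\mathrm{At}$); $X(x)$ abbreviates $x\subseteq X$. $T_{\mathrm{base}}$ is the $\mathcal{L}$-theory stating: $\subseteq$ is the order of an atomic Boolean algebra (one-element algebra allowed); $\lhd$ linearly orders the atoms; $\bot$ is least; $\mathrm{At}$ holds exactly of atoms; $\forall X\forall Y(X\lhd Y\leftrightarrow\exists x\exists y(X(x)\wedge Y(y)\wedge x\lhd y))$; and for every $\mathcal{L}$-formula $\eta(x;\bar Y)$, $\forall\bar Y\exists X\forall x(X(x)\leftrightarrow\eta(x;\bar Y))$. For $M,N\models T_{\mathrm{base}}$, $M\oplus N$ is the $\mathcal{L}$-structure with universe $|M|\times|N|$, $\subseteq$ componentwise, $\bot$ and $\mathrm{At}$ the bottom and atoms of the resulting product Boolean algebra, and $(A,B)\lhd(C,D)$ iff ($A\neq\bot$ in $M$ and $D\neq\bot$ in $N$) or $M\models A\lhd C$ or $N\models B\lhd D$. For $\mathcal{L}$-structures $M,N$, $M\approx_k N$ means $M$ and $N$ satisfy the same unnested $\mathcal{L}$-sentences of quantifier rank at most $k$ (unnested: every atomic subformula has the form $x=y$,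 $x=\bot$, $\mathrm{At}(x)$, $x\subseteq y$ or $x\lhd y$ with $x,y$ variables); equivalently, player II has a winning strategy in the $k$-round Ehrenfeucht–Fraïssé game on $M,N$, where in each round player I picks an element of either structure and II answers in the other, and II wins if the resulting $k$-tuples satisfy the same unnested atomic formulas. -}

module Defs where

open import Data.Nat using (ℕ; zero; suc)
open import Data.Fin using (Fin; zero; suc)
open import Data.Vec using (Vec; []; _∷_; lookup)
open import Data.Product using (Σ; ∃; _×_; _,_)
open import Data.Sum using (_⊎_)
open import Data.Empty using () renaming (⊥ to Empty)
open import Relation.Nullary using (¬_)
open import Relation.Binary.PropositionalEquality using (_≡_)
open import Function.Bundles using (_⇔_)
import Algebra.Lattice.Structures as LS

record Structure : Set₁ where
  field
    Carrier : Set
    _⊆_     : Carrier → Carrier → Set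
    bot     : Carrier
    At      : Carrier → Set
    _◁_     : Carrier → Carrier → Set

open Structure public

-- First-order L-formulas (de Bruijn variables), built from the
-- classically complete connectives falsum, →, ∧, ∀ (so ¬, ∨, ∃, ↔ are
-- the usual classical abbreviations).

data Term (n : ℕ) : Set where
  var  : Fin n → Term n
  botT : Term n

data Formula (n : ℕ) : Set where
  _≐_ _⊑_ _◃_ : Term n → Term n → Formula n
  atF         : Term n → Formula n
  falsum      : Formula n
  _⇒_ _∧f_    : Formula n → Formula n → Formula n
  all         : Formula (suc n) → Formula n

evalT : (M : Structure) {n : ℕ} → Vec (Carrier M) n → Term n → Carrier M
evalT M ρ (var i) = lookup ρ i
evalT M ρ botT    = bot M

Sat : (M : Structure) {n : ℕ} → Vec (Carrier M) n → Formula n → Set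
Sat M ρ (s ≐ t)  = evalT M ρ s ≡ evalT M ρ t
Sat M ρ (s ⊑ t)  = _⊆_ M (evalT M ρ s) (evalT M ρ t)
Sat M ρ (s ◃ t)  = _◁_ M (evalT M ρ s) (evalT M ρ t)
Sat M ρ (atF t)  = At M (evalT M ρ t)
Sat M ρ falsum   = Empty
Sat M ρ (φ ⇒ ψ)  = Sat M ρ φ → Sat M ρ ψ
Sat M ρ (φ ∧f ψ) = Sat M ρ φ × Sat M ρ ψ
Sat M ρ (all φ)  = (a : Carrier M) → Sat M (a ∷ ρ) φ

record IsTbase (M : Structure) : Set₁ where
  private
    C = Carrier M
    _⊆ᴹ_ = _⊆_ M
    _◁ᴹ_ = _◁_ M
    ⊥ᴹ = bot M
    Atᴹ = At M
  field
    join meet : C → C → C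
    compl     : C → C
    top       : C
    isBooleanAlgebra : LS.IsBooleanAlgebra (_≡_ {A = C}) join meet compl top ⊥ᴹ
    ⊆-is-order : ∀ X Y → (X ⊆ᴹ Y) ⇔ (meet X Y ≡ X)
    At-atom : ∀ x → Atᴹ x ⇔ ((¬ x ≡ ⊥ᴹ) × (∀ y → y ⊆ᴹ x → (y ≡ ⊥ᴹ) ⊎ (y ≡ x)))
    atomic : ∀ X → ¬ X ≡ ⊥ᴹ → Σ C λ x → Atᴹ x × x ⊆ᴹ X
    ◁-irrefl : ∀ x → Atᴹ x → ¬ (x ◁ᴹ x)
    ◁-trans  : ∀ x y z → Atᴹ x → Atᴹ y → Atᴹ z → x ◁ᴹ y → y ◁ᴹ z → x ◁ᴹ z
    ◁-total  : ∀ x y → Atᴹ x → Atᴹ y → (x ◁ᴹ y) ⊎ ((x ≡ y) ⊎ (y ◁ᴹ x))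
    ◁-ext : ∀ X Y → (X ◁ᴹ Y) ⇔
              (Σ C λ x → Σ C λ y →
                 Atᴹ x × Atᴹ y × x ⊆ᴹ X × y ⊆ᴹ Y × x ◁ᴹ y)
    comprehension : ∀ {m} (η : Formula (suc m)) (Ys : Vec C m) →
      Σ C λ X → ∀ x → Atᴹ x → ((x ⊆ᴹ X) ⇔ Sat M (x ∷ Ys) η)

_⊕_ : Structure → Structure → Structure
M ⊕ N = record
  { Carrier = Carrier M × Carrier N
  ; _⊆_ = λ { (A , B) (C , D) → _⊆_ M A C × _⊆_ N B D }
  ; bot = (bot M , bot N)
  -- atoms of the product Boolean algebra: (a , ⊥) and (⊥ , b)
  ; At = λ { (A , B) → (At M A × B ≡ bot N) ⊎ (A ≡ bot M × At N B) }
  ; _◁_ = λ { (A , B) (C , D) →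
        ((¬ A ≡ bot M) × (¬ D ≡ bot N)) ⊎ (_◁_ M A C ⊎ _◁_ N B D) }
  }

SameAtomic : (M N : Structure) {n : ℕ} → Vec (Carrier M) n → Vec (Carrier N) n → Set
SameAtomic M N {n} as bs =
  ∀ (i j : Fin n) →
    ((lookup as i ≡ lookup as j) ⇔ (lookup bs i ≡ lookup bs j)) ×
    ((lookup as i ≡ bot M) ⇔ (lookup bs i ≡ bot N)) ×
    (At M (lookup as i) ⇔ At N (lookup bs i)) ×
    (_⊆_ M (lookup as i) (lookup as j) ⇔ _⊆_ N (lookup bs i) (lookup bs j)) ×
    (_◁_ M (lookup as i) (lookup as j) ⇔ _◁_ N (lookup bs i) (lookup bs j))

EFWin : (M N : Structure) (r : ℕ) {n : ℕ} → Vec (Carrier M) n → Vec (Carrier N) n → Set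
EFWin M N zero    as bs = SameAtomic M N as bs
EFWin M N (suc r) as bs =
  (∀ (a : Carrier M) → Σ (Carrier N) λ b → EFWin M N r (a ∷ as) (b ∷ bs)) ×
  (∀ (b : Carrier N) → Σ (Carrier M) λ a → EFWin M N r (a ∷ as) (b ∷ bs))

_≈[_]_ : Structure → ℕ → Structure → Set
M ≈[ k ] N = EFWin M N k [] []

{-# OPTIONS --safe #-}
module Submission where

open import Defs
open import Data.Nat using (ℕ; zero; suc)
open import Data.Vec using (Vec; []; _∷_; lookup; zip)
open import Data.Vec.Properties using (lookup-zip)
open import Data.Product using (Σ; _×_; _,_; proj₁; proj₂)
open import Data.Product.Properties using (×-≡,≡↔≡)
open import Data.Product.Function.NonDependent.Propositional using (_×-⇔_)
open import Data.Sum.Function.Propositional using (_⊎-⇔_)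
open import Relation.Binary.PropositionalEquality using (_≡_)
open import Function.Bundles using (_⇔_)
open import Function.Properties.Equivalence using () renaming (sym to ⇔-sym; trans to ⇔-trans)
open import Function.Properties.Inverse using (↔⇒⇔)
open import Function.Related.TypeIsomorphisms using (¬-cong-⇔)

-- II wins the game on M₁ ⊕ M₂ and N₁ ⊕ N₂ by playing the two component games
-- in parallel.  Every unnested atomic formula of the sum is a Boolean
-- combination of unnested atomic formulas of the components, so agreement on
-- the components gives agreement on the sum.

AtomicAgree : (M N : Structure) → Carrier M → Carrier M → Carrier N → Carrier N → Set
AtomicAgree M N a a′ b b′ =
  ((a ≡ a′) ⇔ (b ≡ b′)) ×
  ((a ≡ bot M) ⇔ (b ≡ bot N)) ×
  (At M a ⇔ At N b) ×
  (_⊆_ M a a′ ⇔ _⊆_ N b b′) ×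
  (_◁_ M a a′ ⇔ _◁_ N b b′)

pair-≡-cong-⇔ : {A B C D : Set} {a a′ : A} {b b′ : B} {c c′ : C} {d d′ : D} →
  (a ≡ a′) ⇔ (c ≡ c′) → (b ≡ b′) ⇔ (d ≡ d′) →
  ((a , b) ≡ (a′ , b′)) ⇔ ((c , d) ≡ (c′ , d′))
pair-≡-cong-⇔ e f = ⇔-trans (⇔-sym (↔⇒⇔ ×-≡,≡↔≡)) (⇔-trans (e ×-⇔ f) (↔⇒⇔ ×-≡,≡↔≡))

-- The bottom agreement for the second argument is needed because the
-- "cross" clause of ◁ in a sum mentions whether that argument is ⊥.
atomicAgree-⊕ : ∀ M₁ M₂ N₁ N₂ {a₁ a₁′ b₁ b₁′ a₂ a₂′ b₂ b₂′} →
  AtomicAgree M₁ N₁ a₁ a₁′ b₁ b₁′ → (a₁′ ≡ bot M₁) ⇔ (b₁′ ≡ bot N₁) →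
  AtomicAgree M₂ N₂ a₂ a₂′ b₂ b₂′ → (a₂′ ≡ bot M₂) ⇔ (b₂′ ≡ bot N₂) →
  AtomicAgree (M₁ ⊕ M₂) (N₁ ⊕ N₂) (a₁ , a₂) (a₁′ , a₂′) (b₁ , b₂) (b₁′ , b₂′)
atomicAgree-⊕ _ _ _ _ (≡₁ , ⊥₁ , At₁ , ⊆₁ , ◁₁) ⊥₁′ (≡₂ , ⊥₂ , At₂ , ⊆₂ , ◁₂) ⊥₂′ =
  pair-≡-cong-⇔ ≡₁ ≡₂ ,
  pair-≡-cong-⇔ ⊥₁ ⊥₂ ,
  ((At₁ ×-⇔ ⊥₂) ⊎-⇔ (⊥₁ ×-⇔ At₂)) ,
  (⊆₁ ×-⇔ ⊆₂) ,
  ((¬-cong-⇔ ⊥₁ ×-⇔ ¬-cong-⇔ ⊥₂′) ⊎-⇔ (◁₁ ⊎-⇔ ◁₂))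

sameAtomic-⊕ : ∀ M₁ M₂ N₁ N₂ {n}
  (as : Vec (Carrier M₁) n) (bs : Vec (Carrier N₁) n)
  (cs : Vec (Carrier M₂) n) (ds : Vec (Carrier N₂) n) →
  SameAtomic M₁ N₁ as bs → SameAtomic M₂ N₂ cs ds →
  SameAtomic (M₁ ⊕ M₂) (N₁ ⊕ N₂) (zip as cs) (zip bs ds)
sameAtomic-⊕ M₁ M₂ N₁ N₂ as bs cs ds agree₁ agree₂ i j
  rewrite lookup-zip i as cs | lookup-zip j as cs | lookup-zip i bs ds | lookup-zip j bs ds =
  atomicAgree-⊕ M₁ M₂ N₁ N₂ (agree₁ i j) (proj₁ (proj₂ (agree₁ j j)))
                             (agree₂ i j) (proj₁ (proj₂ (agree₂ j j)))

efWin-⊕ : ∀ M₁ M₂ N₁ N₂ r {n}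
  (as : Vec (Carrier M₁) n) (bs : Vec (Carrier N₁) n)
  (cs : Vec (Carrier M₂) n) (ds : Vec (Carrier N₂) n) →
  EFWin M₁ N₁ r as bs → EFWin M₂ N₂ r cs ds →
  EFWin (M₁ ⊕ M₂) (N₁ ⊕ N₂) r (zip as cs) (zip bs ds)
efWin-⊕ M₁ M₂ N₁ N₂ zero as bs cs ds win₁ win₂ =
  sameAtomic-⊕ M₁ M₂ N₁ N₂ as bs cs ds win₁ win₂
efWin-⊕ M₁ M₂ N₁ N₂ (suc r) as bs cs ds (forth₁ , back₁) (forth₂ , back₂) = forth , back
  where
  forth : ∀ a → Σ (Carrier (N₁ ⊕ N₂)) λ b →
          EFWin (M₁ ⊕ M₂) (N₁ ⊕ N₂) r (a ∷ zip as cs) (b ∷ zip bs ds)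
  forth (a₁ , a₂) with forth₁ a₁ | forth₂ a₂
  ... | b₁ , win₁ | b₂ , win₂ =
    (b₁ , b₂) , efWin-⊕ M₁ M₂ N₁ N₂ r (a₁ ∷ as) (b₁ ∷ bs) (a₂ ∷ cs) (b₂ ∷ ds) win₁ win₂

  back : ∀ b → Σ (Carrier (M₁ ⊕ M₂)) λ a →
         EFWin (M₁ ⊕ M₂) (N₁ ⊕ N₂) r (a ∷ zip as cs) (b ∷ zip bs ds)
  back (b₁ , b₂) with back₁ b₁ | back₂ b₂
  ... | a₁ , win₁ | a₂ , win₂ =
    (a₁ , a₂) , efWin-⊕ M₁ M₂ N₁ N₂ r (a₁ ∷ as) (b₁ ∷ bs) (a₂ ∷ cs) (b₂ ∷ ds) win₁ win₂

theorem2p23 : (M₁ M₂ N₁ N₂ : Structure) →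
    IsTbase M₁ → IsTbase M₂ → IsTbase N₁ → IsTbase N₂ →
    (k : ℕ) → M₁ ≈[ k ] N₁ → M₂ ≈[ k ] N₂ →
    (M₁ ⊕ M₂) ≈[ k ] (N₁ ⊕ N₂)
theorem2p23 M₁ M₂ N₁ N₂ _ _ _ _ k = efWin-⊕ M₁ M₂ N₁ N₂ k [] [] [] []
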